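{- Let $k>1$ be an integer. The concatenation of any two perfect permutiples, both with multiplier $k$, is again a perfect permutiple (with multiplier $k$).
   Context: For positive integers $a_0,\ldots,a_n$, $[a_0;a_1,\ldots,a_n]$ denotes the finite simple continued fraction $a_0+1/(a_1+1/(\cdots+1/a_n))$; all finite continued fractions are assumed in canonical form (last digit at least $2$ when there are at least two digits). For an integer $k>1$ and a permutation $\sigma$ of $\{0,\ldots,n\}$, $r=[a_0;\ldots,a_n]$ is a $(\sigma,k)$-permutiple (with multiplier $k$) if $r=k\,[a_{\sigma(0)};a_{\sigma(1)},\ldots,a_{\sigma(n)}]$. It is perfect if $a_j=k\,a_{\sigma(j)}$ for every even $j$ and $a_{\sigma(j)}=k\,a_j$ for every odd $j$ ($0\le j\le n$). For $c_1=[b_0;\ldots,b_n]$, $c_2=[b'_0;\ldots,b'_m]$ the concatenation is $c_1\circ c_2=[b_0;\ldots,b_n,b'_0,\ldots,b'_m]$, regarded as a permutiple with respect to the permutation acting as the first permutation on the first $n+1$ positions and as the second (shifted by $n+1$) on the last $m+1$ positions. -}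

module Defs where

open import Data.Nat as ℕ using (ℕ; zero; suc; _≤_)
open import Data.Nat.Divisibility using (_∣_)
open import Data.Integer using (+_)
open import Data.Rational as ℚ using (ℚ; 0ℚ; _/_; 1/_; ≢-nonZero)
open import Data.Fin as Fin using (Fin; toℕ; fromℕ; splitAt; _↑ˡ_; _↑ʳ_)
open import Data.Sum using ([_,_])
open import Data.List using (List; []; _∷_; tabulate)
open import Data.Product using (_×_)
open import Function using (_∘_)
open import Function.Definitions using (Bijective)
open import Relation.Binary.PropositionalEquality using (_≡_)
open import Relation.Nullary using (¬_; yes; no)

⟦_⟧ : ℕ → ℚ
⟦ a ⟧ = + a / 1

-- total reciprocal (value at 0 is irrelevant: it never occurs for positive digits)
inv : ℚ → ℚ
inv q with q ℚ.≟ 0ℚ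
... | yes _ = 0ℚ
... | no q≢0 = 1/_ q {{≢-nonZero q≢0}}

cfList : List ℕ → ℚ
cfList [] = 0ℚ
cfList (a ∷ []) = ⟦ a ⟧
cfList (a ∷ b ∷ r) = ⟦ a ⟧ ℚ.+ inv (cfList (b ∷ r))

cf : ∀ {n} → (Fin (suc n) → ℕ) → ℚ
cf a = cfList (tabulate a)

Positive : ∀ {n} → (Fin (suc n) → ℕ) → Set
Positive a = ∀ i → 1 ≤ a i

Canonical : ∀ {n} → (Fin (suc n) → ℕ) → Set
Canonical {n} a = 1 ≤ n → 2 ≤ a (fromℕ n)

Permutiple : (k n : ℕ) → (Fin (suc n) → ℕ) → (Fin (suc n) → Fin (suc n)) → Set
Permutiple k n a σ =
  Bijective _≡_ _≡_ σ × Positive a × Canonical a × Canonical (a ∘ σ)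
  × cf a ≡ ⟦ k ⟧ ℚ.* cf (a ∘ σ)

PerfectCond : (k n : ℕ) → (Fin (suc n) → ℕ) → (Fin (suc n) → Fin (suc n)) → Set
PerfectCond k n a σ =
  ∀ j → (2 ∣ toℕ j → a j ≡ k ℕ.* a (σ j)) × (¬ (2 ∣ toℕ j) → a (σ j) ≡ k ℕ.* a j)

PerfectPermutiple : (k n : ℕ) → (Fin (suc n) → ℕ) → (Fin (suc n) → Fin (suc n)) → Set
PerfectPermutiple k n a σ = Permutiple k n a σ × PerfectCond k n a σ

concatDigits : ∀ {n m} → (Fin (suc n) → ℕ) → (Fin (suc m) → ℕ) → Fin (suc n ℕ.+ suc m) → ℕ
concatDigits {n} a b i = [ a , b ] (splitAt (suc n) i)

concatPerm : ∀ {n m} → (Fin (suc n) → Fin (suc n)) → (Fin (suc m) → Fin (suc m))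
           → Fin (suc n ℕ.+ suc m) → Fin (suc n ℕ.+ suc m)
concatPerm {n} {m} σ τ i =
  [ (λ x → σ x ↑ˡ suc m) , (λ y → suc n ↑ʳ τ y) ] (splitAt (suc n) i)

module Submission where

-- Call a pair of digit sequences (f , g) k-alternating if f j = k·g j at
-- every even position j and g j = k·f j at every odd one; a permutiple is
-- perfect exactly when (a , a ∘ σ) is k-alternating.  Three facts about
-- alternating pairs carry the proof:
--   * the value lemma: an alternating pair satisfies [f] = k·[g], because
--     dropping the first digit turns (f , g) into the alternating pair of
--     tails (g ∘ suc , f ∘ suc) and 1/[g-tail] = k/(k·[f-tail]);
--   * the product lemma: Π f = k^(L mod 2)·Π g for an alternating pair of
--     length L; for g = a ∘ σ the two products agree, so when k > 1 a
--     perfect permutiple has an even number of digits;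
--   * concatenating two alternating pairs is alternating, provided the first
--     block has even length (so parities of the second block are unchanged).
-- Bijectivity of the combined permutation comes from Fin (n + m) ≅ Fin n ⊎ Fin m,
-- and canonicity of the concatenation is inherited from the second block,
-- which has at least two digits because its length is even.

open import Defs
open import Data.Nat using (ℕ; suc; _<_; _+_)
open import Data.Fin using (Fin)

open import Data.Nat as ℕ using (zero; _≤_; z≤n; s≤s; _*_)
import Data.Nat.Properties as ℕP
open import Data.Nat.Divisibility
  using (_∣_; _∣?_; _∣0; ∣-refl; ∣1⇒≡1; ∣m∣n⇒∣m+n; ∣m+n∣m⇒∣n)
open import Data.Integer using (+_)
open import Data.Rational as ℚ using (ℚ; mkℚ; 0ℚ; 1ℚ)
import Data.Rational.Properties as ℚP
import Data.Integer.Properties as ℤP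
import Data.Nat.Coprimality as Coprimality
open import Data.Fin as Fin using (toℕ; fromℕ; splitAt; join; _↑ˡ_; _↑ʳ_)
open import Data.Fin.Properties
  using (+↔⊎; splitAt-↑ˡ; splitAt-↑ʳ; join-splitAt; toℕ-↑ˡ; toℕ-↑ʳ)
open import Data.Sum as Sum using (_⊎_; inj₁; inj₂)
open import Data.Sum.Function.Propositional using (_⊎-⤖_)
open import Data.Product using (_×_; _,_; proj₁; proj₂)
open import Function using (_∘_)
open import Function.Bundles using (mk⤖; Bijection)
open import Function.Definitions using (Bijective)
open import Function.Properties.Inverse using (↔⇒⤖)
open import Function.Properties.Bijection using (⤖⇒↔)
open import Function.Construct.Composition using (_⤖-∘_)
open import Function.Construct.Symmetry using (↔-sym)
open import Relation.Binary.PropositionalEquality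
open import Relation.Nullary using (¬_; Dec; yes; no; contradiction)
open import Relation.Nullary.Decidable using (decidable-stable)
open import Data.Nat.Tactic.RingSolver using (solve-∀)
open import Algebra.Properties.CommutativeMonoid.Sum ℕP.*-1-commutativeMonoid
  using (sum-permute) renaming (sum to Π)

⟦⟧-as-mkℚ : ∀ a → ⟦ a ⟧ ≡ mkℚ (+ a) 0 (Coprimality.sym (Coprimality.1-coprimeTo a))
⟦⟧-as-mkℚ a = ℚP.normalize-coprime _

⟦⟧-homo-* : ∀ a b → ⟦ a * b ⟧ ≡ ⟦ a ⟧ ℚ.* ⟦ b ⟧
⟦⟧-homo-* a b rewrite ⟦⟧-as-mkℚ a | ⟦⟧-as-mkℚ b | ℤP.+◃n≡+n (a * b) = refl

⟦suc⟧≢0 : ∀ a → ⟦ suc a ⟧ ≢ 0ℚ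
⟦suc⟧≢0 a eq with trans (sym (⟦⟧-as-mkℚ (suc a))) eq
... | ()

inv-inverseˡ : ∀ q → q ≢ 0ℚ → inv q ℚ.* q ≡ 1ℚ
inv-inverseˡ q q≢0 with q ℚ.≟ 0ℚ
... | yes q≡0 = contradiction q≡0 q≢0
... | no q≢0′ = ℚP.*-inverseˡ q {{ℚ.≢-nonZero q≢0′}}

inv-unique : ∀ x q → x ℚ.* q ≡ 1ℚ → x ≡ inv q
inv-unique x q xq≡1 with q ℚ.≟ 0ℚ
... | yes refl = contradiction (trans (sym (ℚP.*-zeroʳ x)) xq≡1) λ ()
... | no q≢0 = begin
  x                           ≡⟨ sym (ℚP.*-identityʳ x) ⟩
  x ℚ.* 1ℚ                    ≡⟨ cong (x ℚ.*_) (ℚP.*-inverseʳ q) ⟨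
  x ℚ.* (q ℚ.* 1/q)           ≡⟨ ℚP.*-assoc x q 1/q ⟨
  (x ℚ.* q) ℚ.* 1/q           ≡⟨ cong (ℚ._* 1/q) xq≡1 ⟩
  1ℚ ℚ.* 1/q                  ≡⟨ ℚP.*-identityˡ 1/q ⟩
  1/q                         ∎
  where
  open ≡-Reasoning
  instance _ = ℚ.≢-nonZero q≢0
  1/q : ℚ
  1/q = ℚ.1/ q

*-≢0 : ∀ p q → p ≢ 0ℚ → q ≢ 0ℚ → p ℚ.* q ≢ 0ℚ
*-≢0 p q p≢0 q≢0 pq≡0 = q≢0 (begin
  q                     ≡⟨ ℚP.*-identityˡ q ⟨
  1ℚ ℚ.* q              ≡⟨ cong (ℚ._* q) (inv-inverseˡ p p≢0) ⟨
  (inv p ℚ.* p) ℚ.* q   ≡⟨ ℚP.*-assoc (inv p) p q ⟩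
  inv p ℚ.* (p ℚ.* q)   ≡⟨ cong (inv p ℚ.*_) pq≡0 ⟩
  inv p ℚ.* 0ℚ          ≡⟨ ℚP.*-zeroʳ (inv p) ⟩
  0ℚ                    ∎)
  where open ≡-Reasoning

scale-inv : ∀ K q → K ≢ 0ℚ → K ℚ.* inv (K ℚ.* q) ≡ inv q
scale-inv K q K≢0 = by-cases (q ℚ.≟ 0ℚ)
  where
  open ≡-Reasoning
  by-cases : Dec (q ≡ 0ℚ) → K ℚ.* inv (K ℚ.* q) ≡ inv q
  by-cases (yes refl) rewrite ℚP.*-zeroʳ K = ℚP.*-zeroʳ K
  by-cases (no q≢0) = inv-unique (K ℚ.* inv (K ℚ.* q)) q (begin
    (K ℚ.* inv (K ℚ.* q)) ℚ.* q   ≡⟨ cong (ℚ._* q) (ℚP.*-comm K _) ⟩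
    (inv (K ℚ.* q) ℚ.* K) ℚ.* q   ≡⟨ ℚP.*-assoc (inv (K ℚ.* q)) K q ⟩
    inv (K ℚ.* q) ℚ.* (K ℚ.* q)   ≡⟨ inv-inverseˡ (K ℚ.* q) (*-≢0 K q K≢0 q≢0) ⟩
    1ℚ                            ∎)

¬2∣1 : ¬ 2 ∣ 1
¬2∣1 2∣1 with ∣1⇒≡1 2∣1
... | ()

even⇒suc-odd : ∀ x → 2 ∣ x → ¬ 2 ∣ suc x
even⇒suc-odd x 2∣x 2∣1+x = ¬2∣1 (∣m+n∣m⇒∣n (subst (2 ∣_) (ℕP.+-comm 1 x) 2∣1+x) 2∣x)

odd⇒suc-even : ∀ x → ¬ 2 ∣ x → 2 ∣ suc x
odd⇒suc-even zero          x-odd = contradiction (2 ∣0) x-odd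
odd⇒suc-even (suc zero)    _     = ∣-refl
odd⇒suc-even (suc (suc x)) x-odd =
  ∣m∣n⇒∣m+n ∣-refl (odd⇒suc-even x (x-odd ∘ ∣m∣n⇒∣m+n ∣-refl))

suc-odd⇒even : ∀ x → ¬ 2 ∣ suc x → 2 ∣ x
suc-odd⇒even x x+1-odd = decidable-stable (2 ∣? x) (x+1-odd ∘ odd⇒suc-even x)

even-shift : ∀ d x → 2 ∣ d → (2 ∣ d + x → 2 ∣ x) × (2 ∣ x → 2 ∣ d + x)
even-shift d x 2∣d = (λ 2∣d+x → ∣m+n∣m⇒∣n 2∣d+x 2∣d) , ∣m∣n⇒∣m+n 2∣d

Alternating : ∀ {L} → ℕ → (Fin L → ℕ) → (Fin L → ℕ) → Set
Alternating k f g =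
  ∀ j → (2 ∣ toℕ j → f j ≡ k * g j) × (¬ 2 ∣ toℕ j → g j ≡ k * f j)

alternating-tail : ∀ {L} k {f g : Fin (suc L) → ℕ}
  → Alternating k f g → Alternating k (g ∘ Fin.suc) (f ∘ Fin.suc)
alternating-tail k alt j =
    (λ j-even → proj₂ (alt (Fin.suc j)) (even⇒suc-odd (toℕ j) j-even))
  , (λ j-odd → proj₁ (alt (Fin.suc j)) (odd⇒suc-even (toℕ j) j-odd))

alternating-congʳ : ∀ {L} k {f g g′ : Fin L → ℕ}
  → g ≗ g′ → Alternating k f g → Alternating k f g′
alternating-congʳ k g≗g′ alt j rewrite sym (g≗g′ j) = alt j

cf-alternating : ∀ {n} k (f g : Fin (suc n) → ℕ)
  → ⟦ k ⟧ ≢ 0ℚ → Alternating k f g → cf f ≡ ⟦ k ⟧ ℚ.* cf g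
cf-alternating {zero} k f g _ alt =
  trans (cong ⟦_⟧ (proj₁ (alt Fin.zero) (2 ∣0))) (⟦⟧-homo-* k (g Fin.zero))
cf-alternating {suc n} k f g k≢0 alt = begin
  ⟦ f₀ ⟧ ℚ.+ inv F                              ≡⟨ cong (λ x → ⟦ x ⟧ ℚ.+ inv F) (proj₁ (alt Fin.zero) (2 ∣0)) ⟩
  ⟦ k * g₀ ⟧ ℚ.+ inv F                          ≡⟨ cong₂ ℚ._+_ (⟦⟧-homo-* k g₀) (sym (scale-inv K F k≢0)) ⟩
  K ℚ.* ⟦ g₀ ⟧ ℚ.+ K ℚ.* inv (K ℚ.* F)          ≡⟨ cong (λ x → K ℚ.* ⟦ g₀ ⟧ ℚ.+ K ℚ.* inv x) tails ⟨
  K ℚ.* ⟦ g₀ ⟧ ℚ.+ K ℚ.* inv G                  ≡⟨ ℚP.*-distribˡ-+ K ⟦ g₀ ⟧ (inv G) ⟨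
  K ℚ.* (⟦ g₀ ⟧ ℚ.+ inv G)                      ∎
  where
  open ≡-Reasoning
  K F G : ℚ
  K = ⟦ k ⟧
  F = cf (f ∘ Fin.suc)
  G = cf (g ∘ Fin.suc)
  f₀ g₀ : ℕ
  f₀ = f Fin.zero
  g₀ = g Fin.zero
  tails : G ≡ K ℚ.* F
  tails = cf-alternating k (g ∘ Fin.suc) (f ∘ Fin.suc) k≢0 (alternating-tail k alt)

product-alternating-even : ∀ {L} k (f g : Fin L → ℕ)
  → 2 ∣ L → Alternating k f g → Π f ≡ Π g
product-alternating-odd : ∀ {L} k (f g : Fin L → ℕ)
  → ¬ 2 ∣ L → Alternating k f g → Π f ≡ k * Π g

product-alternating-even {zero} k f g _ _ = refl
product-alternating-even {suc L} k f g L+1-even alt = begin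
  f₀ * Π (f ∘ Fin.suc)         ≡⟨ cong (_* Π (f ∘ Fin.suc)) (proj₁ (alt Fin.zero) (2 ∣0)) ⟩
  k * g₀ * Π (f ∘ Fin.suc)     ≡⟨ rearrange k g₀ (Π (f ∘ Fin.suc)) ⟩
  g₀ * (k * Π (f ∘ Fin.suc))   ≡⟨ cong (g₀ *_) tails ⟨
  g₀ * Π (g ∘ Fin.suc)         ∎
  where
  open ≡-Reasoning
  f₀ g₀ : ℕ
  f₀ = f Fin.zero
  g₀ = g Fin.zero
  rearrange : ∀ x y z → x * y * z ≡ y * (x * z)
  rearrange = solve-∀
  tails : Π (g ∘ Fin.suc) ≡ k * Π (f ∘ Fin.suc)
  tails = product-alternating-odd k (g ∘ Fin.suc) (f ∘ Fin.suc)
            (λ L-even → even⇒suc-odd L L-even L+1-even)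
            (alternating-tail k alt)

product-alternating-odd {zero} k f g L-odd _ = contradiction (2 ∣0) L-odd
product-alternating-odd {suc L} k f g L+1-odd alt = begin
  f₀ * Π (f ∘ Fin.suc)         ≡⟨ cong (_* Π (f ∘ Fin.suc)) (proj₁ (alt Fin.zero) (2 ∣0)) ⟩
  k * g₀ * Π (f ∘ Fin.suc)     ≡⟨ cong (k * g₀ *_) tails ⟩
  k * g₀ * Π (g ∘ Fin.suc)     ≡⟨ ℕP.*-assoc k g₀ (Π (g ∘ Fin.suc)) ⟩
  k * (g₀ * Π (g ∘ Fin.suc))   ∎
  where
  open ≡-Reasoning
  f₀ g₀ : ℕ
  f₀ = f Fin.zero
  g₀ = g Fin.zero
  tails : Π (f ∘ Fin.suc) ≡ Π (g ∘ Fin.suc)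
  tails = sym (product-alternating-even k (g ∘ Fin.suc) (f ∘ Fin.suc)
            (suc-odd⇒even L L+1-odd)
            (alternating-tail k alt))

product-positive : ∀ {L} (f : Fin L → ℕ) → (∀ j → 1 ≤ f j) → 1 ≤ Π f
product-positive {zero} f _ = s≤s z≤n
product-positive {suc L} f f-pos =
  ℕP.*-mono-≤ (f-pos Fin.zero) (product-positive (f ∘ Fin.suc) (f-pos ∘ Fin.suc))

product-permute : ∀ {L} (σ : Fin L → Fin L) → Bijective _≡_ _≡_ σ
  → (f : Fin L → ℕ) → Π (f ∘ σ) ≡ Π f
product-permute σ σ-bij f = sym (sum-permute f (⤖⇒↔ (mk⤖ σ-bij)))

-- With k > 1, a perfect permutiple has an even number of digits: for an odd
-- number the product lemma would give Π a = k · Π (a ∘ σ) = k · Π a.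
perfect-even-length : ∀ {n k} (a : Fin (suc n) → ℕ) (σ : Fin (suc n) → Fin (suc n))
  → 1 < k → Bijective _≡_ _≡_ σ → Positive a → PerfectCond k n a σ → 2 ∣ suc n
perfect-even-length {n} {k} a σ 1<k σ-bij a-pos perfect with 2 ∣? suc n
... | yes length-even = length-even
... | no length-odd = contradiction k≡1 (ℕP.<⇒≢ 1<k)
  where
  Πa≡k*Πa : 1 * Π a ≡ k * Π a
  Πa≡k*Πa = trans (ℕP.*-identityˡ (Π a))
    (trans (product-alternating-odd k a (a ∘ σ) length-odd perfect)
           (cong (k *_) (product-permute σ σ-bij a)))
  k≡1 : 1 ≡ k
  k≡1 = ℕP.*-cancelʳ-≡ 1 k (Π a) {{ℕ.>-nonZero (product-positive a a-pos)}} Πa≡k*Πa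

splitAt-ind : ∀ {n m} (P : Fin (n + m) → Set)
  → (∀ x → P (x ↑ˡ m)) → (∀ y → P (n ↑ʳ y)) → ∀ i → P i
splitAt-ind {n} {m} P left right i = subst P (join-splitAt n m i) (by-block (splitAt n i))
  where
  by-block : (s : Fin n ⊎ Fin m) → P (join n m s)
  by-block (inj₁ x) = left x
  by-block (inj₂ y) = right y

bijective-cong : ∀ {A B : Set} {f g : A → B} → f ≗ g → Bijective _≡_ _≡_ f → Bijective _≡_ _≡_ g
bijective-cong f≗g (f-inj , f-surj) =
    (λ {x} {y} gx≡gy → f-inj (trans (f≗g x) (trans gx≡gy (sym (f≗g y)))))
  , (λ z → proj₁ (f-surj z) , λ { refl → trans (sym (f≗g _)) (proj₂ (f-surj z) refl) })

canonical-cong : ∀ {n} {f g : Fin (suc n) → ℕ} → f ≗ g → Canonical f → Canonical g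
canonical-cong {n} f≗g f-can n≥1 = subst (2 ≤_) (f≗g (fromℕ n)) (f-can n≥1)

fromℕ-↑ʳ : ∀ n m → fromℕ (n + suc m) ≡ suc n ↑ʳ fromℕ m
fromℕ-↑ʳ zero     m = refl
fromℕ-↑ʳ (suc n) m = cong Fin.suc (fromℕ-↑ʳ n m)

module _ {n m : ℕ} where

  concatDigits-↑ˡ : ∀ (a : Fin (suc n) → ℕ) (b : Fin (suc m) → ℕ) x
    → concatDigits a b (x ↑ˡ suc m) ≡ a x
  concatDigits-↑ˡ a b x rewrite splitAt-↑ˡ (suc n) x (suc m) = refl

  concatDigits-↑ʳ : ∀ (a : Fin (suc n) → ℕ) (b : Fin (suc m) → ℕ) y
    → concatDigits a b (suc n ↑ʳ y) ≡ b y
  concatDigits-↑ʳ a b y rewrite splitAt-↑ʳ (suc n) (suc m) y = refl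

  concatPerm-as-sum : ∀ (σ : Fin (suc n) → Fin (suc n)) (τ : Fin (suc m) → Fin (suc m))
    → join (suc n) (suc m) ∘ Sum.map σ τ ∘ splitAt (suc n) ≗ concatPerm σ τ
  concatPerm-as-sum σ τ i with splitAt (suc n) i
  ... | inj₁ _ = refl
  ... | inj₂ _ = refl

  concatPerm-bijective : ∀ {σ : Fin (suc n) → Fin (suc n)} {τ : Fin (suc m) → Fin (suc m)}
    → Bijective _≡_ _≡_ σ → Bijective _≡_ _≡_ τ → Bijective _≡_ _≡_ (concatPerm σ τ)
  concatPerm-bijective {σ} {τ} σ-bij τ-bij = bijective-cong (concatPerm-as-sum σ τ)
    (Bijection.bijective (↔⇒⤖ (↔-sym +↔⊎) ⤖-∘ ((mk⤖ σ-bij ⊎-⤖ mk⤖ τ-bij) ⤖-∘ ↔⇒⤖ +↔⊎)))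

  concat-permute : ∀ (a : Fin (suc n) → ℕ) (σ : Fin (suc n) → Fin (suc n))
                     (b : Fin (suc m) → ℕ) (τ : Fin (suc m) → Fin (suc m))
    → concatDigits (a ∘ σ) (b ∘ τ) ≗ concatDigits a b ∘ concatPerm σ τ
  concat-permute a σ b τ i with splitAt (suc n) i
  ... | inj₁ x = sym (concatDigits-↑ˡ a b (σ x))
  ... | inj₂ y = sym (concatDigits-↑ʳ a b (τ y))

  concat-positive : ∀ {a : Fin (suc n) → ℕ} {b : Fin (suc m) → ℕ}
    → Positive a → Positive b → Positive (concatDigits a b)
  concat-positive {a} {b} a-pos b-pos = splitAt-ind (λ i → 1 ≤ concatDigits a b i)
    (λ x → subst (1 ≤_) (sym (concatDigits-↑ˡ a b x)) (a-pos x))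
    (λ y → subst (1 ≤_) (sym (concatDigits-↑ʳ a b y)) (b-pos y))

  concat-canonical : ∀ {a : Fin (suc n) → ℕ} {b : Fin (suc m) → ℕ}
    → 1 ≤ m → Canonical b → Canonical (concatDigits a b)
  concat-canonical {a} {b} m≥1 b-can _ rewrite fromℕ-↑ʳ n m =
    subst (2 ≤_) (sym (concatDigits-↑ʳ a b (fromℕ m))) (b-can m≥1)

  concat-alternating : ∀ k {a a′ : Fin (suc n) → ℕ} {b b′ : Fin (suc m) → ℕ}
    → 2 ∣ suc n → Alternating k a a′ → Alternating k b b′
    → Alternating k (concatDigits a b) (concatDigits a′ b′)
  concat-alternating k {a} {a′} {b} {b′} n+1-even a-alt b-alt = splitAt-ind ConditionAt left right
    where
    c c′ : Fin (suc n + suc m) → ℕ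
    c = concatDigits a b
    c′ = concatDigits a′ b′
    ConditionAt : Fin (suc n + suc m) → Set
    ConditionAt i = (2 ∣ toℕ i → c i ≡ k * c′ i) × (¬ 2 ∣ toℕ i → c′ i ≡ k * c i)
    left : (x : Fin (suc n)) → ConditionAt (x ↑ˡ suc m)
    left x rewrite toℕ-↑ˡ x (suc m) | concatDigits-↑ˡ a b x | concatDigits-↑ˡ a′ b′ x = a-alt x
    right : (y : Fin (suc m)) → ConditionAt (suc n ↑ʳ y)
    right y rewrite toℕ-↑ʳ (suc n) y | concatDigits-↑ʳ a b y | concatDigits-↑ʳ a′ b′ y =
      let (from-even , to-even) = even-shift (suc n) (toℕ y) n+1-even
      in (proj₁ (b-alt y) ∘ from-even) , (proj₂ (b-alt y) ∘ (_∘ to-even))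

even-length⇒≥2 : ∀ m → 2 ∣ suc m → 1 ≤ m
even-length⇒≥2 zero    2∣1 = contradiction 2∣1 ¬2∣1
even-length⇒≥2 (suc m) _   = s≤s z≤n

corollary27 : (k : ℕ) → 1 < k → (n m : ℕ)
    → (a : Fin (suc n) → ℕ) (σ : Fin (suc n) → Fin (suc n))
    → (b : Fin (suc m) → ℕ) (τ : Fin (suc m) → Fin (suc m))
    → PerfectPermutiple k n a σ → PerfectPermutiple k m b τ
    → PerfectPermutiple k (n + suc m) (concatDigits a b) (concatPerm σ τ)
corollary27 k@(suc k′) 1<k n m a σ b τ
  ((σ-bij , a-pos , _ , _ , _) , a-perfect) ((τ-bij , b-pos , b-can , bτ-can , _) , b-perfect) =
  ( ( concatPerm-bijective σ-bij τ-bij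
    , concat-positive a-pos b-pos
    , concat-canonical m≥1 b-can
    , canonical-cong (concat-permute a σ b τ) (concat-canonical m≥1 bτ-can)
    , cf-alternating k (concatDigits a b) _ (⟦suc⟧≢0 k′) perfect )
  , perfect )
  where
  n+1-even : 2 ∣ suc n
  n+1-even = perfect-even-length a σ 1<k σ-bij a-pos a-perfect
  m≥1 : 1 ≤ m
  m≥1 = even-length⇒≥2 m (perfect-even-length b τ 1<k τ-bij b-pos b-perfect)
  perfect : PerfectCond k (n + suc m) (concatDigits a b) (concatPerm σ τ)
  perfect = alternating-congʳ k (concat-permute a σ b τ)
              (concat-alternating k n+1-even a-perfect b-perfect)
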